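{- Let $p$ be a prime, and let $V\subseteq\{0,1\}^{4p}\subseteq\mathbb{F}_p^{4p}$ be the set of characteristic vectors of all $2p$-element subsets of $[4p]$. Let $C\subseteq[4p]$ with $|C|=3p$, let $v_C$ be its characteristic vector, and put $Q=V\cup\{v_C\}$. If $y\in\mathrm{Sm}(\prec_{deg},Q)\setminus\mathrm{Sm}(\prec_{deg},V)$, then $\deg(y)\ge p$.
   Context: $[m]=\{1,\ldots,m\}$. $\prec_{deg}$ is the deglex order on monomials of $\mathbb{F}_p[x_1,\ldots,x_{4p}]$: $u\prec_{deg}v$ iff $\deg u<\deg v$, or $\deg u=\deg v$ and at the smallest index $k$ where the exponents of $x_k$ differ, $u$ has the smaller exponent. $\mathrm{Sm}(\prec,S)$ is the set of monomials that are not the $\prec$-leading monomial of any nonzero polynomial in $\mathbb{F}_p[x_1,\ldots,x_{4p}]$ vanishing on $S$. -}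

module Defs where

open import Data.Nat using (ℕ; zero; suc; _+_; _*_; _^_; _<_; _≤_)
open import Data.Nat.Divisibility using (_∣_)
import Data.Nat.Properties as ℕP
open import Data.Bool using (Bool; true; false; if_then_else_)
open import Data.Vec using (Vec; []; _∷_; foldr; zipWith; sum; map)
open import Data.Vec.Properties using (≡-dec)
open import Data.List using (List; []; _∷_)
open import Data.Product using (_×_; _,_; ∃; Σ)
open import Data.Sum using (_⊎_)
open import Data.Empty using (⊥)
open import Data.Fin.Subset using (Subset; ∣_∣)
open import Relation.Nullary using (¬_; yes; no)
open import Relation.Binary.PropositionalEquality using (_≡_)

Monomial : ℕ → Set
Monomial n = Vec ℕ n

deg : ∀ {n} → Monomial n → ℕ
deg = sum

_<lex_ : ∀ {n} → Monomial n → Monomial n → Set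
[] <lex [] = ⊥
(a ∷ u) <lex (b ∷ v) = (a < b) ⊎ ((a ≡ b) × (u <lex v))

_≺deg_ : ∀ {n} → Monomial n → Monomial n → Set
u ≺deg v = (deg u < deg v) ⊎ ((deg u ≡ deg v) × (u <lex v))

-- Polynomials over F_p: a finite list of terms (monomial, coefficient),
-- coefficients are natural numbers read modulo p (so F_p = ℕ / pℕ).
Poly : ℕ → Set
Poly n = List (Monomial n × ℕ)

coeff : ∀ {n} → Poly n → Monomial n → ℕ
coeff [] m = 0
coeff ((u , c) ∷ f) m with ≡-dec ℕP._≟_ u m
... | yes _ = c + coeff f m
... | no  _ = coeff f m

evalMon : ∀ {n} → Monomial n → Vec ℕ n → ℕ
evalMon e x = foldr _ _*_ 1 (zipWith _^_ x e)

eval : ∀ {n} → Poly n → Vec ℕ n → ℕ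
eval [] x = 0
eval ((u , c) ∷ f) x = c * evalMon u x + eval f x

VanishesOn : ∀ {n} → ℕ → (Vec ℕ n → Set) → Poly n → Set
VanishesOn p S f = ∀ x → S x → p ∣ eval f x

IsLeadingMonomial : ∀ {n} → ℕ → (Monomial n → Monomial n → Set) → Poly n → Monomial n → Set
IsLeadingMonomial p _≺_ f m =
  (¬ (p ∣ coeff f m)) × (∀ u → ¬ (p ∣ coeff f u) → (u ≡ m) ⊎ (u ≺ m))

Sm : ∀ {n} → ℕ → (Monomial n → Monomial n → Set) → (Vec ℕ n → Set) → Monomial n → Set
Sm p _≺_ S m = ¬ (Σ (Poly _) λ f → VanishesOn p S f × IsLeadingMonomial p _≺_ f m)

χ : ∀ {n} → Subset n → Vec ℕ n
χ = map (λ b → if b then 1 else 0)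

UniformFamily : (n k : ℕ) → Vec ℕ n → Set
UniformFamily n k x = ∃ λ (s : Subset n) → (∣ s ∣ ≡ k) × (x ≡ χ s)

-- Suppose deg y < p and f vanishes on V with leading monomial y. Every monomial of f
-- whose coefficient is nonzero mod p then has degree < p, so modulo p the polynomial f
-- agrees everywhere with its part of degree < p. Such a polynomial g also vanishes at
-- v_C: choose p + 1 elements of C and sum g over the 2p-sets formed by them and p − 1
-- further elements of C. The sum is 0 mod p because every term is. Counting the sets
-- containing the support of a monomial u shows that u contributes u(v_C) times a
-- binomial coefficient (p + j choose j) with j < p, which is 1 mod p. Hence f vanishes
-- on Q and still has leading monomial y, so y ∉ Sm(Q). The argument works verbatim for
-- k-sets of [n] and |C| = k + tp with k ≥ p − 1.
module Submission where

open import Defs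
open import Data.Nat using (ℕ; zero; suc; pred; _+_; _*_; _^_; _∸_; _<_; _≤_; _<?_; s≤s; z≤n; NonZero)
open import Data.Nat.Properties
open import Data.Nat.Combinatorics
  using (nC1≡n; nCn≡1; k>n⇒nCk≡0; nCk+nC[k+1]≡[n+1]C[k+1]) renaming (_C_ to _choose_)
open import Data.Nat.Divisibility
  using (_∣_; _∣?_; _∣0; divides; ∣⇒≤; ∣m⇒∣m*n; ∣m∣n⇒∣m+n; n∣m⇒m%n≡0; m%n≡0⇒n∣m)
open import Data.Nat.DivMod using (_%_; %-distribˡ-+; %-distribˡ-*; %-remove-+ʳ; m*n%n≡0)
open import Data.Nat.Primality using (Prime; euclidsLemma; prime⇒nonZero)
open import Data.Bool using (true; false)
open import Data.Fin.Subset using (Subset; ∣_∣)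
open import Data.Vec using (Vec; []; _∷_)
open import Data.Vec.Properties using (≡-dec)
open import Data.List using ([]; _∷_; length; filter)
open import Data.List.Properties using (filter-notAll)
open import Data.List.Relation.Unary.All as All using (All; []; _∷_)
open import Data.List.Relation.Unary.All.Properties using (all-filter)
open import Data.List.Relation.Unary.Any using (here)
open import Data.Product using (_,_; proj₁)
open import Data.Sum using (_⊎_; inj₁; inj₂)
open import Data.Empty using (⊥-elim)
open import Function using (_∘_)
open import Level using (Level; 0ℓ)
open import Relation.Nullary using (¬_; yes; no; contradiction)
open import Relation.Unary using (Pred; Decidable)
open import Relation.Unary.Properties using (∁?)
open import Relation.Binary.Bundles using (Setoid)
open import Relation.Binary.Definitions using (DecidableEquality)
open import Relation.Binary.PropositionalEquality
import Relation.Binary.Reasoning.Setoid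
open import Algebra.Properties.CommutativeSemigroup +-commutativeSemigroup using (x∙yz≈y∙xz; interchange)

private variable
  ℓ : Level
  n : ℕ

-- Binomial coefficients modulo a prime

pascal : ∀ n k → suc n choose suc k ≡ n choose k + n choose suc k
pascal n k = sym (nCk+nC[k+1]≡[n+1]C[k+1] n k)

[1+k]*[1+n]C[1+k]≡[1+n]*nCk : ∀ n k → suc k * (suc n choose suc k) ≡ suc n * (n choose k)
[1+k]*[1+n]C[1+k]≡[1+n]*nCk zero zero = refl
[1+k]*[1+n]C[1+k]≡[1+n]*nCk zero (suc k) = begin
  suc (suc k) * (1 choose suc (suc k)) ≡⟨ cong (suc (suc k) *_) (k>n⇒nCk≡0 {1} {suc (suc k)} (s≤s (s≤s z≤n))) ⟩
  suc (suc k) * 0                      ≡⟨ *-zeroʳ (suc (suc k)) ⟩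
  0                                    ≡⟨ cong (1 *_) (k>n⇒nCk≡0 {0} {suc k} (s≤s z≤n)) ⟨
  1 * (0 choose suc k)                 ∎
  where open ≡-Reasoning
[1+k]*[1+n]C[1+k]≡[1+n]*nCk (suc n) zero =
  trans (*-identityˡ _) (trans (nC1≡n (suc (suc n))) (sym (*-identityʳ (suc (suc n)))))
[1+k]*[1+n]C[1+k]≡[1+n]*nCk (suc n) (suc k) = begin
  suc (suc k) * (suc (suc n) choose suc (suc k))
    ≡⟨ cong (suc (suc k) *_) (pascal (suc n) (suc k)) ⟩
  suc (suc k) * (a + b)
    ≡⟨ *-distribˡ-+ (suc (suc k)) a b ⟩
  (a + suc k * a) + suc (suc k) * b
    ≡⟨ cong₂ (λ x y → (a + x) + y) ([1+k]*[1+n]C[1+k]≡[1+n]*nCk n k) ([1+k]*[1+n]C[1+k]≡[1+n]*nCk n (suc k)) ⟩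
  (a + suc n * (n choose k)) + suc n * (n choose suc k)
    ≡⟨ +-assoc a _ _ ⟩
  a + (suc n * (n choose k) + suc n * (n choose suc k))
    ≡⟨ cong (a +_) (*-distribˡ-+ (suc n) (n choose k) (n choose suc k)) ⟨
  a + suc n * (n choose k + n choose suc k)
    ≡⟨ cong (λ z → a + suc n * z) (pascal n k) ⟨
  suc (suc n) * a
    ∎
  where
  open ≡-Reasoning
  a = suc n choose suc k
  b = suc n choose suc (suc k)

p∣pCk : ∀ {p k} → Prime p → 0 < k → k < p → p ∣ p choose k
p∣pCk {suc n} {suc j} p-prime _ j<p
  with euclidsLemma (suc j) (suc n choose suc j) p-prime
         (divides (n choose j) (trans ([1+k]*[1+n]C[1+k]≡[1+n]*nCk n j) (*-comm (suc n) (n choose j))))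
... | inj₁ p∣k   = contradiction (∣⇒≤ p∣k) (<⇒≱ j<p)
... | inj₂ p∣pCk = p∣pCk

-- A record rather than a synonym for a % p ≡ b % p, so that a and b can be inferred.
infix 4 _≡_mod_
record _≡_mod_ (a b p : ℕ) .{{_ : NonZero p}} : Set where
  constructor mk≡mod
  field
    %-≡ : a % p ≡ b % p

module _ {p : ℕ} .{{_ : NonZero p}} where

  ≡⇒≡mod : ∀ {a b} → a ≡ b → a ≡ b mod p
  ≡⇒≡mod a≡b = mk≡mod (cong (_% p) a≡b)

  ≡mod-sym : ∀ {a b} → a ≡ b mod p → b ≡ a mod p
  ≡mod-sym (mk≡mod e) = mk≡mod (sym e)

  ≡mod-setoid : Setoid 0ℓ 0ℓ
  ≡mod-setoid = record
    { Carrier       = ℕ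
    ; _≈_           = λ a b → a ≡ b mod p
    ; isEquivalence = record
      { refl  = mk≡mod refl
      ; sym   = ≡mod-sym
      ; trans = λ (mk≡mod e) (mk≡mod f) → mk≡mod (trans e f)
      }
    }

  ≡mod-+ : ∀ {a b c d} → a ≡ b mod p → c ≡ d mod p → a + c ≡ b + d mod p
  ≡mod-+ {a} {b} {c} {d} (mk≡mod a≡b) (mk≡mod c≡d) = mk≡mod (begin
    (a + c) % p             ≡⟨ %-distribˡ-+ a c p ⟩
    (a % p + c % p) % p     ≡⟨ cong₂ (λ x y → (x + y) % p) a≡b c≡d ⟩
    (b % p + d % p) % p     ≡⟨ %-distribˡ-+ b d p ⟨
    (b + d) % p             ∎)
    where open ≡-Reasoning

  ≡mod-*ˡ : ∀ c {a b} → a ≡ b mod p → c * a ≡ c * b mod p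
  ≡mod-*ˡ c {a} {b} (mk≡mod a≡b) = mk≡mod (begin
    (c * a) % p             ≡⟨ %-distribˡ-* c a p ⟩
    (c % p * (a % p)) % p   ≡⟨ cong (λ x → (c % p * x) % p) a≡b ⟩
    (c % p * (b % p)) % p   ≡⟨ %-distribˡ-* c b p ⟨
    (c * b) % p             ∎)
    where open ≡-Reasoning

  ∣⇒≡0mod : ∀ {a} → p ∣ a → a ≡ 0 mod p
  ∣⇒≡0mod {a} p∣a = mk≡mod (trans (n∣m⇒m%n≡0 a p p∣a) (sym (m*n%n≡0 0 p)))

  ∣-resp-≡mod : ∀ {a b} → a ≡ b mod p → p ∣ a → p ∣ b
  ∣-resp-≡mod {a} {b} (mk≡mod a≡b) p∣a = m%n≡0⇒n∣m b p (trans (sym a≡b) (n∣m⇒m%n≡0 a p p∣a))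

module ≡mod-Reasoning (p : ℕ) .{{_ : NonZero p}} = Relation.Binary.Reasoning.Setoid (≡mod-setoid {p})

module _ {p : ℕ} (p-prime : Prime p) where

  private instance
    p≢0 : NonZero p
    p≢0 = prime⇒nonZero p-prime

  open ≡mod-Reasoning p

  [p+m]Cj≡mCj : ∀ m {j} → j < p → (p + m) choose j ≡ m choose j mod p
  [p+m]Cj≡mCj zero {zero} _ = mk≡mod refl
  [p+m]Cj≡mCj zero {suc j} j<p = begin
    (p + 0) choose suc j ≡⟨ cong (_choose suc j) (+-identityʳ p) ⟩
    p choose suc j       ≈⟨ ∣⇒≡0mod (p∣pCk p-prime (s≤s z≤n) j<p) ⟩
    0                    ≡⟨ k>n⇒nCk≡0 {0} {suc j} (s≤s z≤n) ⟨
    0 choose suc j       ∎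
  [p+m]Cj≡mCj (suc m) {zero} _ = mk≡mod refl
  [p+m]Cj≡mCj (suc m) {suc j} j<p = begin
    (p + suc m) choose suc j                ≡⟨ cong (_choose suc j) (+-suc p m) ⟩
    suc (p + m) choose suc j                ≡⟨ pascal (p + m) j ⟩
    (p + m) choose j + (p + m) choose suc j ≈⟨ ≡mod-+ ([p+m]Cj≡mCj m (<-trans (n<1+n j) j<p)) ([p+m]Cj≡mCj m j<p) ⟩
    m choose j + m choose suc j             ≡⟨ pascal m j ⟨
    suc m choose suc j                      ∎

  [tp+j]Cj≡1 : ∀ t {j} → j < p → (t * p + j) choose j ≡ 1 mod p
  [tp+j]Cj≡1 zero {j} _ = ≡⇒≡mod (nCn≡1 j)
  [tp+j]Cj≡1 (suc t) {j} j<p = begin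
    (p + t * p + j) choose j   ≡⟨ cong (_choose j) (+-assoc p (t * p) j) ⟩
    (p + (t * p + j)) choose j ≈⟨ [p+m]Cj≡mCj (t * p + j) j<p ⟩
    (t * p + j) choose j       ≈⟨ [tp+j]Cj≡1 t j<p ⟩
    1                          ∎

-- Polynomials restricted to a set of monomials

evalWith : (Monomial n → ℕ) → Poly n → ℕ
evalWith h []            = 0
evalWith h ((u , c) ∷ f) = c * h u + evalWith h f

eval≡evalWith : ∀ (f : Poly n) x → eval f x ≡ evalWith (λ u → evalMon u x) f
eval≡evalWith []            x = refl
eval≡evalWith ((u , c) ∷ f) x = cong (c * evalMon u x +_) (eval≡evalWith f x)

evalWith-cong-mod : ∀ {p} .{{_ : NonZero p}} {h h′ : Monomial n → ℕ} {f} →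
                    All (λ term → h (proj₁ term) ≡ h′ (proj₁ term) mod p) f →
                    evalWith h f ≡ evalWith h′ f mod p
evalWith-cong-mod []                                  = mk≡mod refl
evalWith-cong-mod {f = (u , c) ∷ _} (hu≡h′u ∷ h≡h′) = ≡mod-+ (≡mod-*ˡ c hu≡h′u) (evalWith-cong-mod h≡h′)

_≟ₘ_ : DecidableEquality (Monomial n)
_≟ₘ_ = ≡-dec _≟_

restrict : {P : Pred (Monomial n) ℓ} → Decidable P → Poly n → Poly n
restrict P? = filter (P? ∘ proj₁)

module _ {P : Pred (Monomial n) ℓ} (P? : Decidable P) where

  coeff-restrict : ∀ f {u} → P u → coeff (restrict P? f) u ≡ coeff f u
  coeff-restrict [] _ = refl
  coeff-restrict ((v , c) ∷ f) {u} Pu with P? v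
  ... | yes _ with ≡-dec _≟_ v u
  ...   | yes _ = cong (c +_) (coeff-restrict f Pu)
  ...   | no _  = coeff-restrict f Pu
  coeff-restrict ((v , c) ∷ f) {u} Pu | no ¬Pv with ≡-dec _≟_ v u
  ...   | yes refl = ⊥-elim (¬Pv Pu)
  ...   | no _     = coeff-restrict f Pu

  coeff-restrict-∁ : ∀ f {u} → ¬ P u → coeff (restrict P? f) u ≡ 0
  coeff-restrict-∁ [] _ = refl
  coeff-restrict-∁ ((v , c) ∷ f) {u} ¬Pu with P? v
  ... | no _ = coeff-restrict-∁ f ¬Pu
  ... | yes Pv with ≡-dec _≟_ v u
  ...   | yes refl = ⊥-elim (¬Pu Pv)
  ...   | no _     = coeff-restrict-∁ f ¬Pu

  eval-restrict : ∀ f x → eval f x ≡ eval (restrict P? f) x + eval (restrict (∁? P?) f) x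
  eval-restrict [] x = refl
  eval-restrict ((v , c) ∷ f) x with P? v
  ... | yes _ = trans (cong (c * evalMon v x +_) (eval-restrict f x))
                      (sym (+-assoc (c * evalMon v x) (eval (restrict P? f) x) (eval (restrict (∁? P?) f) x)))
  ... | no _  = trans (cong (c * evalMon v x +_) (eval-restrict f x))
                      (x∙yz≈y∙xz (c * evalMon v x) (eval (restrict P? f) x) (eval (restrict (∁? P?) f) x))

eval-restrict-≟ : ∀ (f : Poly n) u x → eval (restrict (_≟ₘ u) f) x ≡ coeff f u * evalMon u x
eval-restrict-≟ []            u x = refl
eval-restrict-≟ ((v , c) ∷ f) u x with ≡-dec _≟_ v u
... | yes refl = trans (cong (c * evalMon v x +_) (eval-restrict-≟ f v x))
                       (sym (*-distribʳ-+ (evalMon v x) c (coeff f v)))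
... | no _     = eval-restrict-≟ f u x

remove : Monomial n → Poly n → Poly n
remove u = restrict (∁? (_≟ₘ u))

eval-remove : ∀ (f : Poly n) u x → eval f x ≡ coeff f u * evalMon u x + eval (remove u f) x
eval-remove f u x = trans (eval-restrict (_≟ₘ u) f x) (cong (_+ eval (remove u f) x) (eval-restrict-≟ f u x))

length-remove-head : ∀ u c (f : Poly n) → length (remove u ((u , c) ∷ f)) ≤ length f
length-remove-head u c f = ≤-pred (filter-notAll (∁? (_≟ₘ u) ∘ proj₁) ((u , c) ∷ f) (here λ u≢u → u≢u refl))

∣coeff-remove : ∀ {d} (f : Poly n) u → (∀ w → d ∣ coeff f w) → ∀ w → d ∣ coeff (remove u f) w
∣coeff-remove {d = d} f u d∣coeff w with w ≟ₘ u
... | yes refl = subst (d ∣_) (sym (coeff-restrict-∁ (∁? (_≟ₘ u)) f λ u≢u → u≢u refl)) (d ∣0)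
... | no w≢u   = subst (d ∣_) (sym (coeff-restrict (∁? (_≟ₘ u)) f w≢u)) (d∣coeff w)

∣coeff⇒∣eval : ∀ {d} (f : Poly n) → (∀ u → d ∣ coeff f u) → ∀ x → d ∣ eval f x
∣coeff⇒∣eval {n} {d} f = bounded (length f) f ≤-refl
  where
  bounded : ∀ m (f : Poly n) → length f ≤ m → (∀ u → d ∣ coeff f u) → ∀ x → d ∣ eval f x
  bounded _       []                 _            _       _ = d ∣0
  bounded (suc m) f@((u , c) ∷ g) (s≤s |g|≤m) d∣coeff x =
    subst (d ∣_) (sym (eval-remove f u x))
      (∣m∣n⇒∣m+n (∣m⇒∣m*n (evalMon u x) (d∣coeff u))
                 (bounded m (remove u f) (≤-trans (length-remove-head u c g) |g|≤m) (∣coeff-remove f u d∣coeff) x))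

lowPart : ℕ → Poly n → Poly n
lowPart p = restrict (λ u → deg u <? p)

lowPart-low : ∀ p (f : Poly n) → All (λ term → deg (proj₁ term) < p) (lowPart p f)
lowPart-low p = all-filter ((λ u → deg u <? p) ∘ proj₁)

eval-≡mod-lowPart : ∀ {p} .{{_ : NonZero p}} (f : Poly n) → (∀ u → ¬ p ∣ coeff f u → deg u < p) →
                    ∀ x → eval f x ≡ eval (lowPart p f) x mod p
eval-≡mod-lowPart {p = p} f low x = mk≡mod (begin
  eval f x % p                             ≡⟨ cong (_% p) (eval-restrict low? f x) ⟩
  (eval (lowPart p f) x + eval high x) % p ≡⟨ %-remove-+ʳ (eval (lowPart p f) x) (∣coeff⇒∣eval high p∣coeff-high x) ⟩
  eval (lowPart p f) x % p                 ∎)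
  where
  open ≡-Reasoning
  low? = λ (u : Monomial _) → deg u <? p
  high = restrict (∁? low?) f
  p∣coeff-high : ∀ u → p ∣ coeff high u
  p∣coeff-high u with deg u <? p | p ∣? coeff f u
  ... | yes u-low | _       = subst (p ∣_) (sym (coeff-restrict-∁ (∁? low?) f λ u-high → u-high u-low)) (p ∣0)
  ... | no u-high | yes p∣c = subst (p ∣_) (sym (coeff-restrict (∁? low?) f u-high)) p∣c
  ... | no u-high | no p∤c  = contradiction (low u p∤c) u-high

deg-≤-leading : ∀ {p} (f : Poly n) {y} → IsLeadingMonomial p _≺deg_ f y →
                ∀ u → ¬ p ∣ coeff f u → deg u ≤ deg y
deg-≤-leading f (_ , maximal) u p∤coeff with maximal u p∤coeff
... | inj₁ refl              = ≤-refl
... | inj₂ (inj₁ deg<)       = <⇒≤ deg<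
... | inj₂ (inj₂ (deg≡ , _)) = ≤-reflexive deg≡

Sm-antitone : ∀ {p} {_≺_ : Monomial n → Monomial n → Set} {S T : Vec ℕ n → Set} {y} →
              (∀ f → VanishesOn p S f → IsLeadingMonomial p _≺_ f y → VanishesOn p T f) →
              Sm p _≺_ T y → Sm p _≺_ S y
Sm-antitone extend smT (f , vanS , leading) = smT (f , extend f vanS leading , leading)

-- Sums over the sets lying between two fixed sets

-- choiceSum r k g sums g over the 0/1 vectors that are 0 on the off coordinates, 1 on the
-- on coordinates, and have exactly k ones among the free coordinates.
data Role : Set where
  off on free : Role

choiceSum : Vec Role n → ℕ → (Vec ℕ n → ℕ) → ℕ
choiceSum []         zero    g = g []
choiceSum []         (suc k) g = 0
choiceSum (off  ∷ r) k       g = choiceSum r k (g ∘ (0 ∷_))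
choiceSum (on   ∷ r) k       g = choiceSum r k (g ∘ (1 ∷_))
choiceSum (free ∷ r) zero    g = choiceSum r zero (g ∘ (0 ∷_))
choiceSum (free ∷ r) (suc k) g = choiceSum r (suc k) (g ∘ (0 ∷_)) + choiceSum r k (g ∘ (1 ∷_))

choiceSum-*ˡ : ∀ (r : Vec Role n) k c g → choiceSum r k (λ x → c * g x) ≡ c * choiceSum r k g
choiceSum-*ˡ []         zero    c g = refl
choiceSum-*ˡ []         (suc k) c g = sym (*-zeroʳ c)
choiceSum-*ˡ (off  ∷ r) k       c g = choiceSum-*ˡ r k c _
choiceSum-*ˡ (on   ∷ r) k       c g = choiceSum-*ˡ r k c _
choiceSum-*ˡ (free ∷ r) zero    c g = choiceSum-*ˡ r zero c _
choiceSum-*ˡ (free ∷ r) (suc k) c g =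
  trans (cong₂ _+_ (choiceSum-*ˡ r (suc k) c _) (choiceSum-*ˡ r k c _)) (sym (*-distribˡ-+ c _ _))

choiceSum-0 : ∀ (r : Vec Role n) k → choiceSum r k (λ _ → 0) ≡ 0
choiceSum-0 r k = choiceSum-*ˡ r k 0 (λ _ → 0)

choiceSum-+ : ∀ (r : Vec Role n) k g h → choiceSum r k (λ x → g x + h x) ≡ choiceSum r k g + choiceSum r k h
choiceSum-+ []         zero    g h = refl
choiceSum-+ []         (suc k) g h = refl
choiceSum-+ (off  ∷ r) k       g h = choiceSum-+ r k _ _
choiceSum-+ (on   ∷ r) k       g h = choiceSum-+ r k _ _
choiceSum-+ (free ∷ r) zero    g h = choiceSum-+ r zero _ _
choiceSum-+ (free ∷ r) (suc k) g h =
  trans (cong₂ _+_ (choiceSum-+ r (suc k) g₀ h₀) (choiceSum-+ r k g₁ h₁))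
        (interchange (choiceSum r (suc k) g₀) (choiceSum r (suc k) h₀) (choiceSum r k g₁) (choiceSum r k h₁))
  where
  g₀ = g ∘ (0 ∷_)
  h₀ = h ∘ (0 ∷_)
  g₁ = g ∘ (1 ∷_)
  h₁ = h ∘ (1 ∷_)

choiceSum-eval : ∀ (r : Vec Role n) k f → choiceSum r k (eval f) ≡ evalWith (λ u → choiceSum r k (evalMon u)) f
choiceSum-eval r k [] = choiceSum-0 r k
choiceSum-eval r k ((u , c) ∷ f) =
  trans (choiceSum-+ r k (λ x → c * evalMon u x) (eval f))
        (cong₂ _+_ (choiceSum-*ˡ r k c (evalMon u)) (choiceSum-eval r k f))

-- The number of k-subsets of an (a + b)-set that contain a fixed b-subset.
containing : ℕ → ℕ → ℕ → ℕ
containing a zero    k       = a choose k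
containing a (suc b) zero    = 0
containing a (suc b) (suc k) = containing a b k

containing-suc-0 : ∀ a b → containing (suc a) b 0 ≡ containing a b 0
containing-suc-0 a zero    = refl
containing-suc-0 a (suc b) = refl

containing-pascal : ∀ a b k → containing (suc a) b (suc k) ≡ containing a b k + containing a b (suc k)
containing-pascal a zero    k       = pascal a k
containing-pascal a (suc b) zero    = containing-suc-0 a b
containing-pascal a (suc b) (suc k) = containing-pascal a b k

containing-+ : ∀ a b j → containing a b (b + j) ≡ a choose j
containing-+ a zero    j = refl
containing-+ a (suc b) j = containing-+ a b j

point : Vec Role n → Vec ℕ n
point []         = []
point (off  ∷ r) = 0 ∷ point r
point (on   ∷ r) = 1 ∷ point r
point (free ∷ r) = 1 ∷ point r

#on #free : Vec Role n → ℕ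
#on []         = 0
#on (off  ∷ r) = #on r
#on (on   ∷ r) = suc (#on r)
#on (free ∷ r) = #on r
#free []         = 0
#free (off  ∷ r) = #free r
#free (on   ∷ r) = #free r
#free (free ∷ r) = suc (#free r)

unusedFree usedFree : Vec Role n → Monomial n → ℕ
unusedFree []         []          = 0
unusedFree (free ∷ r) (zero  ∷ u) = suc (unusedFree r u)
unusedFree (free ∷ r) (suc _ ∷ u) = unusedFree r u
unusedFree (off  ∷ r) (_     ∷ u) = unusedFree r u
unusedFree (on   ∷ r) (_     ∷ u) = unusedFree r u
usedFree []         []          = 0
usedFree (free ∷ r) (zero  ∷ u) = usedFree r u
usedFree (free ∷ r) (suc _ ∷ u) = suc (usedFree r u)
usedFree (off  ∷ r) (_     ∷ u) = usedFree r u
usedFree (on   ∷ r) (_     ∷ u) = usedFree r u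

unusedFree+usedFree : ∀ (r : Vec Role n) u → unusedFree r u + usedFree r u ≡ #free r
unusedFree+usedFree []         []          = refl
unusedFree+usedFree (free ∷ r) (zero  ∷ u) = cong suc (unusedFree+usedFree r u)
unusedFree+usedFree (free ∷ r) (suc _ ∷ u) =
  trans (+-suc (unusedFree r u) (usedFree r u)) (cong suc (unusedFree+usedFree r u))
unusedFree+usedFree (off  ∷ r) (_     ∷ u) = unusedFree+usedFree r u
unusedFree+usedFree (on   ∷ r) (_     ∷ u) = unusedFree+usedFree r u

usedFree≤deg : ∀ (r : Vec Role n) u → usedFree r u ≤ deg u
usedFree≤deg []         []          = z≤n
usedFree≤deg (free ∷ r) (zero  ∷ u) = usedFree≤deg r u
usedFree≤deg (free ∷ r) (suc e ∷ u) = s≤s (≤-trans (usedFree≤deg r u) (m≤n+m (deg u) e))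
usedFree≤deg (off  ∷ r) (e     ∷ u) = ≤-trans (usedFree≤deg r u) (m≤n+m (deg u) e)
usedFree≤deg (on   ∷ r) (e     ∷ u) = ≤-trans (usedFree≤deg r u) (m≤n+m (deg u) e)

choiceSum-evalMon : ∀ (r : Vec Role n) u k →
  choiceSum r k (evalMon u) ≡ evalMon u (point r) * containing (unusedFree r u) (usedFree r u) k

choiceSum-*evalMon : ∀ c (r : Vec Role n) u k →
  choiceSum r k (λ x → c * evalMon u x) ≡ (c * evalMon u (point r)) * containing (unusedFree r u) (usedFree r u) k
choiceSum-*evalMon c r u k =
  trans (choiceSum-*ˡ r k c (evalMon u)) (trans (cong (c *_) (choiceSum-evalMon r u k)) (sym (*-assoc c _ _)))

choiceSum-evalMon []         []          zero    = refl
choiceSum-evalMon []         []          (suc k) = sym (k>n⇒nCk≡0 {0} {suc k} (s≤s z≤n))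
choiceSum-evalMon (off  ∷ r) (e     ∷ u) k       = choiceSum-*evalMon (0 ^ e) r u k
choiceSum-evalMon (on   ∷ r) (e     ∷ u) k       = choiceSum-*evalMon (1 ^ e) r u k
choiceSum-evalMon (free ∷ r) (zero  ∷ u) zero    =
  trans (choiceSum-*evalMon 1 r u 0)
        (cong (1 * evalMon u (point r) *_) (sym (containing-suc-0 (unusedFree r u) (usedFree r u))))
choiceSum-evalMon (free ∷ r) (zero  ∷ u) (suc k) = begin
  choiceSum r (suc k) (λ x → 1 * evalMon u x) + choiceSum r k (λ x → 1 * evalMon u x)
    ≡⟨ cong₂ _+_ (choiceSum-*evalMon 1 r u (suc k)) (choiceSum-*evalMon 1 r u k) ⟩
  E * containing a b (suc k) + E * containing a b k
    ≡⟨ +-comm (E * containing a b (suc k)) _ ⟩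
  E * containing a b k + E * containing a b (suc k)
    ≡⟨ *-distribˡ-+ E (containing a b k) _ ⟨
  E * (containing a b k + containing a b (suc k))
    ≡⟨ cong (E *_) (containing-pascal a b k) ⟨
  E * containing (suc a) b (suc k) ∎
  where
  open ≡-Reasoning
  E = 1 * evalMon u (point r)
  a = unusedFree r u
  b = usedFree r u
choiceSum-evalMon (free ∷ r) (suc e ∷ u) zero    =
  trans (choiceSum-0 r 0) (sym (*-zeroʳ (1 ^ suc e * evalMon u (point r))))
choiceSum-evalMon (free ∷ r) (suc e ∷ u) (suc k) =
  trans (cong (_+ choiceSum r k (λ x → 1 ^ suc e * evalMon u x)) (choiceSum-0 r (suc k)))
        (choiceSum-*evalMon (1 ^ suc e) r u k)

choiceSum-∣ : ∀ {d} (r : Vec Role n) k g → (∀ s → ∣ s ∣ ≡ #on r + k → d ∣ g (χ s)) → d ∣ choiceSum r k g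
choiceSum-∣         []         zero    g d∣g = d∣g [] refl
choiceSum-∣ {d = d} []         (suc k) g d∣g = d ∣0
choiceSum-∣         (off  ∷ r) k       g d∣g = choiceSum-∣ r k _ (λ s |s| → d∣g (false ∷ s) |s|)
choiceSum-∣         (on   ∷ r) k       g d∣g = choiceSum-∣ r k _ (λ s |s| → d∣g (true ∷ s) (cong suc |s|))
choiceSum-∣         (free ∷ r) zero    g d∣g = choiceSum-∣ r zero _ (λ s |s| → d∣g (false ∷ s) |s|)
choiceSum-∣         (free ∷ r) (suc k) g d∣g =
  ∣m∣n⇒∣m+n (choiceSum-∣ r (suc k) _ (λ s |s| → d∣g (false ∷ s) |s|))
            (choiceSum-∣ r k _ (λ s |s| → d∣g (true ∷ s) (trans (cong suc |s|) (sym (+-suc (#on r) k)))))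

split : ℕ → Subset n → Vec Role n
split m       []          = []
split m       (false ∷ C) = off ∷ split m C
split zero    (true  ∷ C) = free ∷ split zero C
split (suc m) (true  ∷ C) = on ∷ split m C

point-split : ∀ m (C : Subset n) → point (split m C) ≡ χ C
point-split m       []          = refl
point-split m       (false ∷ C) = cong (0 ∷_) (point-split m C)
point-split zero    (true  ∷ C) = cong (1 ∷_) (point-split zero C)
point-split (suc m) (true  ∷ C) = cong (1 ∷_) (point-split m C)

#on-split : ∀ m (C : Subset n) → m ≤ ∣ C ∣ → #on (split m C) ≡ m
#on-split zero    []          _           = refl
#on-split m       (false ∷ C) m≤|C|       = #on-split m C m≤|C|
#on-split zero    (true  ∷ C) _           = #on-split zero C z≤n
#on-split (suc m) (true  ∷ C) (s≤s m≤|C|) = cong suc (#on-split m C m≤|C|)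

#free-split : ∀ m (C : Subset n) → m ≤ ∣ C ∣ → #free (split m C) + m ≡ ∣ C ∣
#free-split zero    []          _           = refl
#free-split m       (false ∷ C) m≤|C|       = #free-split m C m≤|C|
#free-split zero    (true  ∷ C) _           = cong suc (#free-split zero C z≤n)
#free-split (suc m) (true  ∷ C) (s≤s m≤|C|) = trans (+-suc _ m) (cong suc (#free-split m C m≤|C|))

-- Low-degree polynomials vanishing on a uniform family

module _ {p : ℕ} (p-prime : Prime p) where

  private instance
    p≢0 : NonZero p
    p≢0 = prime⇒nonZero p-prime

  containing-≡1 : ∀ t {a b} → b ≤ pred p → a + b ≡ t * p + pred p → containing a b (pred p) ≡ 1 mod p
  containing-≡1 t {a} {b} b≤q a+b≡tp+q = begin
    containing a b q            ≡⟨ cong (containing a b) (m+[n∸m]≡n b≤q) ⟨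
    containing a b (b + j)      ≡⟨ containing-+ a b j ⟩
    a choose j                  ≡⟨ cong (_choose j) a≡tp+j ⟩
    (t * p + j) choose j        ≈⟨ [tp+j]Cj≡1 p-prime t (m≤pred[n]⇒suc[m]≤n (m∸n≤m q b)) ⟩
    1                           ∎
    where
    open ≡mod-Reasoning p
    q = pred p
    j = q ∸ b
    a≡tp+j : a ≡ t * p + j
    a≡tp+j = trans (sym (m+n∸n≡m a b)) (trans (cong (_∸ b) a+b≡tp+q) (+-∸-assoc (t * p) b≤q))

  low-degree-vanishing⇒vanishes-at-χ :
    ∀ k t (C : Subset n) → pred p ≤ k → ∣ C ∣ ≡ t * p + k →
    (f : Poly n) → All (λ term → deg (proj₁ term) < p) f →
    VanishesOn p (UniformFamily n k) f → p ∣ eval f (χ C)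
  low-degree-vanishing⇒vanishes-at-χ {n} k t C q≤k |C|≡tp+k f low vanishes =
    ∣-resp-≡mod choiceSum≡eval p∣choiceSum
    where
    q = pred p
    m = k ∸ q
    r = split m C
    m≤k : m ≤ k
    m≤k = m∸n≤m k q
    m≤|C| : m ≤ ∣ C ∣
    m≤|C| = subst (m ≤_) (sym |C|≡tp+k) (≤-trans m≤k (m≤n+m k (t * p)))
    #free≡tp+q : #free r ≡ t * p + q
    #free≡tp+q = begin
      #free r                 ≡⟨ m+n∸n≡m (#free r) m ⟨
      #free r + m ∸ m         ≡⟨ cong (_∸ m) (trans (#free-split m C m≤|C|) |C|≡tp+k) ⟩
      t * p + k ∸ m           ≡⟨ +-∸-assoc (t * p) m≤k ⟩
      t * p + (k ∸ m)         ≡⟨ cong (t * p +_) (m∸[m∸n]≡n q≤k) ⟩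
      t * p + q               ∎
      where open ≡-Reasoning
    p∣choiceSum : p ∣ choiceSum r q (eval f)
    p∣choiceSum = choiceSum-∣ r q (eval f) λ s |s|≡ →
      vanishes (χ s) (s , trans |s|≡ (trans (cong (_+ q) (#on-split m C m≤|C|)) (m∸n+n≡m q≤k)) , refl)
    term≡ : ∀ {u} → deg u < p → choiceSum r q (evalMon u) ≡ evalMon u (χ C) mod p
    term≡ {u} deg<p = begin
      choiceSum r q (evalMon u)
        ≡⟨ choiceSum-evalMon r u q ⟩
      evalMon u (point r) * containing (unusedFree r u) (usedFree r u) q
        ≈⟨ ≡mod-*ˡ (evalMon u (point r))
             (containing-≡1 t (≤-trans (usedFree≤deg r u) (<⇒≤pred deg<p)) (trans (unusedFree+usedFree r u) #free≡tp+q)) ⟩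
      evalMon u (point r) * 1
        ≡⟨ *-identityʳ (evalMon u (point r)) ⟩
      evalMon u (point r)
        ≡⟨ cong (evalMon u) (point-split m C) ⟩
      evalMon u (χ C) ∎
      where open ≡mod-Reasoning p
    choiceSum≡eval : choiceSum r q (eval f) ≡ eval f (χ C) mod p
    choiceSum≡eval = begin
      choiceSum r q (eval f)                        ≡⟨ choiceSum-eval r q f ⟩
      evalWith (λ u → choiceSum r q (evalMon u)) f  ≈⟨ evalWith-cong-mod (All.map term≡ low) ⟩
      evalWith (λ u → evalMon u (χ C)) f            ≡⟨ eval≡evalWith f (χ C) ⟨
      eval f (χ C)                                  ∎
      where open ≡mod-Reasoning p

  low-leading-vanishing⇒vanishes-at-χ :
    ∀ k t (C : Subset n) → pred p ≤ k → ∣ C ∣ ≡ t * p + k →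
    ∀ f {y} → IsLeadingMonomial p _≺deg_ f y → deg y < p →
    VanishesOn p (UniformFamily n k) f → p ∣ eval f (χ C)
  low-leading-vanishing⇒vanishes-at-χ {n} k t C q≤k |C|≡tp+k f leading deg-y<p vanishes =
    ∣-resp-≡mod (≡mod-sym (eval-≡mod-lowPart f low (χ C)))
      (low-degree-vanishing⇒vanishes-at-χ k t C q≤k |C|≡tp+k (lowPart p f) (lowPart-low p f) lowPart-vanishes)
    where
    low : ∀ u → ¬ p ∣ coeff f u → deg u < p
    low u p∤coeff = ≤-<-trans (deg-≤-leading f leading u p∤coeff) deg-y<p
    lowPart-vanishes : VanishesOn p (UniformFamily n k) (lowPart p f)
    lowPart-vanishes x x∈V = ∣-resp-≡mod (eval-≡mod-lowPart f low x) (vanishes x x∈V)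

proposition4p8 : (p : ℕ) → Prime p → (C : Subset (4 * p)) → ∣ C ∣ ≡ 3 * p →
    (y : Monomial (4 * p)) →
    Sm p _≺deg_ (λ x → UniformFamily (4 * p) (2 * p) x ⊎ (x ≡ χ C)) y →
    ¬ Sm p _≺deg_ (UniformFamily (4 * p) (2 * p)) y →
    p ≤ deg y
proposition4p8 p p-prime C |C|≡3p y smQ ¬smV =
  ≮⇒≥ λ deg-y<p → ¬smV (Sm-antitone {_≺_ = _≺deg_} (extend deg-y<p) smQ)
  where
  V = UniformFamily (4 * p) (2 * p)
  extend : deg y < p → ∀ f → VanishesOn p V f → IsLeadingMonomial p _≺deg_ f y →
           VanishesOn p (λ x → V x ⊎ (x ≡ χ C)) f
  extend _       f vanishes _       x (inj₁ x∈V) = vanishes x x∈V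
  extend deg-y<p f vanishes leading _ (inj₂ refl) =
    low-leading-vanishing⇒vanishes-at-χ p-prime (2 * p) 1 C (≤-trans pred[n]≤n (m≤m+n p (1 * p)))
      (trans |C|≡3p (*-distribʳ-+ p 1 2)) f leading deg-y<p vanishes
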